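{- There exist sentential logics that are substitution-invariant and monotonic and whose Suszko rank is exactly $4$.
   Context: A sentential logic is a triple $\langle\mathcal{L},\mathcal{C},\vdash\rangle$ where $\mathcal{L}$ is the set of formulae freely generated from a set of atoms by a set $\mathcal{C}$ of connectives, and $\vdash\subseteq\mathcal{P}(\mathcal{L})\times\mathcal{P}(\mathcal{L})$. It is substitution-invariant if $\Gamma\vdash\Delta$ implies $\{\sigma(F):F\in\Gamma\}\vdash\{\sigma(F):F\in\Delta\}$ for every endomorphism $\sigma$ of $\mathcal{L}$; monotonic if $\Gamma_1\subseteq\Gamma_2$, $\Delta_1\subseteq\Delta_2$, $\Gamma_1\vdash\Delta_1$ imply $\Gamma_2\vdash\Delta_2$. A semantics is a triple $\langle\mathcal{V},\mathcal{W},[\![\cdot]\!]\rangle$: truth values $\mathcal{V}$, worlds $\mathcal{W}$, and $[\![\cdot]\!]$ assigning to formulae propositions $\mathcal{W}\to\mathcal{V}$, to connectives functions on tuples of propositions, and to $\vdash$ a relation $\models$ between sets of propositions. It is sound and complete if $\Gamma\vdash\Delta$ iff $\{[\![F]\!]:F\in\Gamma\}\models\{[\![F]\!]:F\in\Delta\}$; truth-relational if there is $\Vdash\subseteq\mathcal{P}(\mathcal{V})\times\mathcal{P}(\mathcal{V})$ with $S\models P$ iff $S(w)\Vdash P(w)$ for all $w$, where $S(w)=\{Q(w):Q\in S\}$. For $D_p,D_c\subseteq\mathcal{V}$, $\gamma\Vdash_{D_p,D_c}\delta$ iff ($\gamma\subseteq D_p$ implies $\delta\cap D_c\neq\emptyset$).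 A semantics is intersective mixed if it is truth-relational and its truth-relation is an intersection of relations of the form $\Vdash_{D_p,D_c}$. The Suszko rank of a logic is the least cardinal $|\mathcal{V}|$ of the set of truth values of a sound and complete intersective mixed semantics for it. -}

module Defs where

open import Level using (0ℓ)
open import Data.Nat using (ℕ; _<_)
open import Data.Fin using (Fin)
open import Data.Product using (Σ; ∃; _×_; _,_)
open import Relation.Unary using (Pred; _⊆_)
open import Relation.Binary.PropositionalEquality using (_≡_)
open import Relation.Nullary using (¬_)
open import Function.Bundles using (_↣_; _⤖_)

data Fm (A C : Set) (ar : C → ℕ) : Set where
  atom : A → Fm A C ar
  app  : (c : C) → (Fin (ar c) → Fm A C ar) → Fm A C ar

-- Endomorphisms of the formula algebra = substitutions of atoms,
-- extended homomorphically.
subst : {A C : Set} {ar : C → ℕ} → (A → Fm A C ar) → Fm A C ar → Fm A C ar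
subst σ (atom p)   = σ p
subst σ (app c fs) = app c (λ i → subst σ (fs i))

Img : {X Y : Set} → (X → Y) → Pred X 0ℓ → Pred Y 0ℓ
Img f S y = ∃ λ x → S x × f x ≡ y

record Logic : Set₁ where
  field
    Atom : Set
    Conn : Set
    ar   : Conn → ℕ
    _⊢_  : Pred (Fm Atom Conn ar) 0ℓ → Pred (Fm Atom Conn ar) 0ℓ → Set

  Formula : Set
  Formula = Fm Atom Conn ar

module _ (L : Logic) where
  open Logic L

  SubstitutionInvariant : Set₁
  SubstitutionInvariant =
    ∀ (σ : Atom → Formula) (Γ Δ : Pred Formula 0ℓ) →
      Γ ⊢ Δ → Img (subst σ) Γ ⊢ Img (subst σ) Δ

  Monotonic : Set₁
  Monotonic =
    ∀ (Γ₁ Γ₂ Δ₁ Δ₂ : Pred Formula 0ℓ) →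
      Γ₁ ⊆ Γ₂ → Δ₁ ⊆ Δ₂ → Γ₁ ⊢ Δ₁ → Γ₂ ⊢ Δ₂

Mixed : {V : Set} → Pred V 0ℓ → Pred V 0ℓ → Pred V 0ℓ → Pred V 0ℓ → Set
Mixed Dp Dc γ δ = γ ⊆ Dp → ∃ λ v → δ v × Dc v

record IMSemantics (L : Logic) : Set₁ where
  open Logic L
  field
    V     : Set
    W     : Set
    atomI : Atom → (W → V)
    connI : (c : Conn) → (Fin (ar c) → (W → V)) → (W → V)
    I     : Set
    Dp    : I → Pred V 0ℓ
    Dc    : I → Pred V 0ℓ

  ⟦_⟧ : Formula → (W → V)
  ⟦ atom p ⟧   = atomI p
  ⟦ app c fs ⟧ = connI c (λ i → ⟦ fs i ⟧)

  _⊩_ : Pred V 0ℓ → Pred V 0ℓ → Set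
  γ ⊩ δ = ∀ (i : I) → Mixed (Dp i) (Dc i) γ δ

  _⊨_ : Pred Formula 0ℓ → Pred Formula 0ℓ → Set
  Γ ⊨ Δ = ∀ (w : W) → Img (λ F → ⟦ F ⟧ w) Γ ⊩ Img (λ F → ⟦ F ⟧ w) Δ

  SoundComplete : Set₁
  SoundComplete = ∀ (Γ Δ : Pred Formula 0ℓ) → (Γ ⊢ Δ → Γ ⊨ Δ) × (Γ ⊨ Δ → Γ ⊢ Δ)

SuszkoRankIs : Logic → ℕ → Set₁
SuszkoRankIs L n =
  (Σ (IMSemantics L) λ S → IMSemantics.SoundComplete S
                         × (IMSemantics.V S ⤖ Fin n))
  × (∀ (S : IMSemantics L) → IMSemantics.SoundComplete S →
       ∀ (m : ℕ) → m < n → ¬ (IMSemantics.V S ↣ Fin m))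

-- The logic has no atoms and four constants, one for each position a value can take
-- with respect to a premise set Dp and a conclusion set Dc; its consequence relation is
-- ⊩_{Dp,Dc} on these four values, which gives a semantics with four values. Conversely, in
-- any sound and complete intersective mixed semantics, soundness puts, at every world and
-- for every component ⊩_{Dp i,Dc i}, the Dp₄-constants into Dp i, the others out of Dp i,
-- and the Dc₄-constants into Dc i. Two constants with the same value must then agree on
-- Dp₄, so one lies in Dc₄ and passes its Dc i-membership to the other. With fewer than four
-- values such a coincidence always exists (pigeonhole), and so the sequent
-- "all Dp₄-constants ⊢ all non-Dc₄-constants", which the logic refutes, would be valid.
module Submission where

open import Level using (0ℓ)
open import Data.Empty using (⊥; ⊥-elim)
open import Data.Unit using (⊤; tt)
open import Data.Nat using (s≤s) renaming (_<_ to _<ℕ_)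
open import Data.Fin using (Fin; zero; suc; _<_)
open import Data.Fin.Properties using (pigeonhole)
open import Data.Product using (Σ; ∃; _×_; _,_; proj₁; proj₂)
open import Function using (_∘_)
open import Function.Bundles using (_↣_; Injection)
open import Function.Construct.Identity using (⤖-id)
open import Relation.Binary.PropositionalEquality
  using (_≡_; refl; sym; _≗_) renaming (subst to ≡-subst)
open import Relation.Nullary using (¬_)
open import Relation.Unary using (Pred; _⊆_; ∅; ｛_｝)

open import Defs

module _ {V : Set} {Dp Dc : Pred V 0ℓ} where

  Mixed-mono : {γ₁ γ₂ δ₁ δ₂ : Pred V 0ℓ} →
               γ₁ ⊆ γ₂ → δ₁ ⊆ δ₂ → Mixed Dp Dc γ₁ δ₁ → Mixed Dp Dc γ₂ δ₂
  Mixed-mono γ₁⊆γ₂ δ₁⊆δ₂ h γ₂⊆Dp with h (γ₂⊆Dp ∘ γ₁⊆γ₂)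
  ... | v , δ₁v , Dcv = v , δ₁⊆δ₂ δ₁v , Dcv

module _ {X Y : Set} where

  Img-mono : {f : X → Y} {S T : Pred X 0ℓ} → S ⊆ T → Img f S ⊆ Img f T
  Img-mono S⊆T (x , Sx , fx≡y) = x , S⊆T Sx , fx≡y

  Img-cong : {f g : X → Y} {S : Pred X 0ℓ} → f ≗ g → Img f S ⊆ Img g S
  Img-cong f≗g (x , Sx , refl) = x , Sx , sym (f≗g x)

  Img-∘ : {Z : Set} {f : X → Z} {g : Z → Y} {S : Pred X 0ℓ} →
           Img (g ∘ f) S ⊆ Img g (Img f S)
  Img-∘ (x , Sx , refl) = _ , (x , Sx , refl) , refl

module _ {L : Logic} (S : IMSemantics L) where
  open Logic L
  open IMSemantics S

  ⊨-theorem⇒Dc : ∀ {F} → ∅ ⊨ ｛ F ｝ → ∀ w i → Dc i (⟦ F ⟧ w)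
  ⊨-theorem⇒Dc ⊨F w i with ⊨F w i (λ { (_ , () , _) })
  ... | _ , (_ , refl , refl) , Dc⟦F⟧ = Dc⟦F⟧

  ⊨-antitheorem⇒¬Dp : ∀ {F} → ｛ F ｝ ⊨ ∅ → ∀ w i → ¬ Dp i (⟦ F ⟧ w)
  ⊨-antitheorem⇒¬Dp F⊨ w i Dp⟦F⟧ with F⊨ w i (λ { (_ , refl , refl) → Dp⟦F⟧ })
  ... | _ , (_ , () , _) , _

Value : Set
Value = Fin 4

pattern both     = zero
pattern premOnly = suc zero
pattern concOnly = suc (suc zero)
pattern neither  = suc (suc (suc zero))

data Dp₄ : Pred Value 0ℓ where
  Dp-both     : Dp₄ both
  Dp-premOnly : Dp₄ premOnly

data Dc₄ : Pred Value 0ℓ where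
  Dc-both     : Dc₄ both
  Dc-concOnly : Dc₄ concOnly

module _ {X : Set} (P C : Pred X 0ℓ) (v : Value → X)
         (preserves-Dp : ∀ {k} → Dp₄ k → P (v k))
         (reflects-Dp  : ∀ {k} → ¬ Dp₄ k → ¬ P (v k))
         (preserves-Dc : ∀ {k} → Dc₄ k → C (v k)) where

  Dp-clash : ∀ {j k} → Dp₄ j → ¬ Dp₄ k → v j ≡ v k → ⊥
  Dp-clash Dp₄j ¬Dp₄k e = reflects-Dp ¬Dp₄k (≡-subst P e (preserves-Dp Dp₄j))

  collision⇒¬reflects-Dc : ∀ {j k} → j < k → v j ≡ v k → ∃ λ l → ¬ Dc₄ l × C (v l)
  collision⇒¬reflects-Dc {both}     {premOnly} _ e = premOnly , (λ ()) , ≡-subst C e (preserves-Dc Dc-both)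
  collision⇒¬reflects-Dc {concOnly} {neither}  _ e = neither , (λ ()) , ≡-subst C e (preserves-Dc Dc-concOnly)
  collision⇒¬reflects-Dc {both}     {concOnly} _ e = ⊥-elim (Dp-clash Dp-both (λ ()) e)
  collision⇒¬reflects-Dc {both}     {neither}  _ e = ⊥-elim (Dp-clash Dp-both (λ ()) e)
  collision⇒¬reflects-Dc {premOnly} {concOnly} _ e = ⊥-elim (Dp-clash Dp-premOnly (λ ()) e)
  collision⇒¬reflects-Dc {premOnly} {neither}  _ e = ⊥-elim (Dp-clash Dp-premOnly (λ ()) e)
  collision⇒¬reflects-Dc {premOnly}          {premOnly} (s≤s ())
  collision⇒¬reflects-Dc {suc (suc _)}       {premOnly} (s≤s ())
  collision⇒¬reflects-Dc {suc (suc _)}       {concOnly} (s≤s (s≤s ()))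
  collision⇒¬reflects-Dc {suc (suc (suc _))} {neither}  (s≤s (s≤s (s≤s ())))

Formula₄ : Set
Formula₄ = Fm ⊥ Value (λ _ → 0)

value : Formula₄ → Value
value (app c _) = c

const : Value → Formula₄
const k = app k (λ ())

_⊢₄_ : Pred Formula₄ 0ℓ → Pred Formula₄ 0ℓ → Set
Γ ⊢₄ Δ = Mixed Dp₄ Dc₄ (Img value Γ) (Img value Δ)

L₄ : Logic
L₄ = record { Atom = ⊥ ; Conn = Value ; ar = λ _ → 0 ; _⊢_ = _⊢₄_ }

value-subst : ∀ (σ : ⊥ → Formula₄) → value ∘ subst σ ≗ value
value-subst σ (app c _) = refl

L₄-substitutionInvariant : SubstitutionInvariant L₄
L₄-substitutionInvariant σ Γ Δ =
  Mixed-mono value-Img-subst value-Img-subst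
  where
  value-Img-subst : ∀ {S} → Img value S ⊆ Img value (Img (subst σ) S)
  value-Img-subst = Img-∘ ∘ Img-cong (sym ∘ value-subst σ)

L₄-monotonic : Monotonic L₄
L₄-monotonic Γ₁ Γ₂ Δ₁ Δ₂ Γ₁⊆Γ₂ Δ₁⊆Δ₂ = Mixed-mono (Img-mono Γ₁⊆Γ₂) (Img-mono Δ₁⊆Δ₂)

S₄ : IMSemantics L₄
S₄ = record { V = Value ; W = ⊤ ; atomI = λ () ; connI = λ c _ _ → c
            ; I = ⊤ ; Dp = λ _ → Dp₄ ; Dc = λ _ → Dc₄ }

module S₄ = IMSemantics S₄

S₄-⟦⟧ : ∀ w → (λ F → S₄.⟦ F ⟧ w) ≗ value
S₄-⟦⟧ w (app c _) = refl

S₄-soundComplete : S₄.SoundComplete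
S₄-soundComplete Γ Δ = sound , complete
  where
  sound : Γ ⊢₄ Δ → Γ S₄.⊨ Δ
  sound ⊢ w _ = Mixed-mono (Img-cong (sym ∘ S₄-⟦⟧ w)) (Img-cong (sym ∘ S₄-⟦⟧ w)) ⊢
  complete : Γ S₄.⊨ Δ → Γ ⊢₄ Δ
  complete ⊨ = Mixed-mono (Img-cong (S₄-⟦⟧ tt)) (Img-cong (S₄-⟦⟧ tt)) (⊨ tt tt)

Γ₀ Δ₀ : Pred Formula₄ 0ℓ
Γ₀ F = Dp₄ (value F)
Δ₀ F = ¬ Dc₄ (value F)

Γ₀⊬₄Δ₀ : ¬ (Γ₀ ⊢₄ Δ₀)
Γ₀⊬₄Δ₀ ⊢ with ⊢ (λ { (_ , Dp₄F , refl) → Dp₄F })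
... | _ , (_ , ¬Dc₄F , refl) , Dc₄F = ¬Dc₄F Dc₄F

module _ (S : IMSemantics L₄) (S-soundComplete : IMSemantics.SoundComplete S) where
  open IMSemantics S

  S-sound : ∀ {Γ Δ} → Γ ⊢₄ Δ → Γ ⊨ Δ
  S-sound {Γ} {Δ} = proj₁ (S-soundComplete Γ Δ)

  const-Dc : ∀ {k} → Dc₄ k → ∀ w i → Dc i (⟦ const k ⟧ w)
  const-Dc {k} Dc₄k = ⊨-theorem⇒Dc S {const k} (S-sound (λ _ → _ , (_ , refl , refl) , Dc₄k))

  const-¬Dp : ∀ {k} → ¬ Dp₄ k → ∀ w i → ¬ Dp i (⟦ const k ⟧ w)
  const-¬Dp {k} ¬Dp₄k = ⊨-antitheorem⇒¬Dp S {const k}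
    (S-sound λ Γ⊆Dp₄ → ⊥-elim (¬Dp₄k (Γ⊆Dp₄ (_ , refl , refl))))

  Γ₀⊨Δ₀ : ∀ {m} → m <ℕ 4 → (V ↣ Fin m) → Γ₀ ⊨ Δ₀
  Γ₀⊨Δ₀ m<4 V↣Fin w i Γ₀⊆Dp =
    let j , k , j<k , e = pigeonhole m<4 (to ∘ v)
        l , ¬Dc₄l , Dc-vl = collision⇒¬reflects-Dc (Dp i) (Dc i) v
                              (λ Dp₄k → Γ₀⊆Dp (const _ , Dp₄k , refl))
                              (λ ¬Dp₄k → const-¬Dp ¬Dp₄k w i)
                              (λ Dc₄k → const-Dc Dc₄k w i)
                              j<k (injective e)
    in v l , (const l , ¬Dc₄l , refl) , Dc-vl
    where
    open Injection V↣Fin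
    v : Value → V
    v k = ⟦ const k ⟧ w

  suszkoRank≥4 : ∀ m → m <ℕ 4 → ¬ (V ↣ Fin m)
  suszkoRank≥4 m m<4 V↣Fin = Γ₀⊬₄Δ₀ (proj₂ (S-soundComplete Γ₀ Δ₀) (Γ₀⊨Δ₀ m<4 V↣Fin))

fact4p6 : Σ Logic λ L → SubstitutionInvariant L × Monotonic L × SuszkoRankIs L 4
fact4p6 = L₄ , L₄-substitutionInvariant , L₄-monotonic
        , (S₄ , S₄-soundComplete , ⤖-id Value) , suszkoRank≥4
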